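{- Let $T$ be a tree with $n$ vertices and let $\bar T$ be its complement. (a) If $\mathrm{diam}(T)\le 2$ then $g(\bar T)=n$. (b) If $\mathrm{diam}(T)=3$ then $g(\bar T)=2$. (c) If $T$ has a vertex of degree two and $\mathrm{diam}(T)>3$ then $g(\bar T)=3$. (d) Otherwise (i.e. $\mathrm{diam}(T)>3$ and $T$ has no vertex of degree two), $g(\bar T)=4$.
   Context: $\mathrm{diam}(T)$ is the diameter of $T$. For a graph $G$ and $S\subseteq V(G)$, $I(S)$ is the set of vertices lying on some shortest $u,v$-path with $u,v\in S$; $S$ is geodetic if $I(S)=V(G)$, and $g(G)$ is the minimum size of a geodetic set. -}

module Defs where

open import Data.Nat using (ℕ; suc; _≤_)
open import Data.Bool using (Bool; true; false; not; _∧_)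
open import Data.Fin using (Fin; _≟_)
open import Data.Fin.Subset using (Subset; ∣_∣; _∈_)
open import Data.Vec using (tabulate)
open import Data.List using (List; []; _∷_; length)
import Data.List.Membership.Propositional as LM
open import Data.List.Relation.Unary.Unique.Propositional using (Unique)
open import Data.Product using (Σ; ∃; _×_)
open import Relation.Binary.PropositionalEquality using (_≡_)
open import Relation.Nullary using (¬_)
open import Relation.Nullary.Decidable using (⌊_⌋)

Graph : ℕ → Set
Graph n = Fin n → Fin n → Bool

Adj : ∀ {n} → Graph n → Fin n → Fin n → Set
Adj G u v = G u v ≡ true

IsSimple : ∀ {n} → Graph n → Set
IsSimple {n} G = (∀ (u v : Fin n) → G u v ≡ G v u) × (∀ (u : Fin n) → G u u ≡ false)

complement : ∀ {n} → Graph n → Graph n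
complement G u v = not (G u v) ∧ not ⌊ u ≟ v ⌋

-- Walk G u v p : the vertex list p is a walk from u to v in G
-- (it has length p ∸ 1 edges).
data Walk {n} (G : Graph n) : Fin n → Fin n → List (Fin n) → Set where
  here : ∀ {u} → Walk G u u (u ∷ [])
  step : ∀ {u w v p} → Adj G u w → Walk G w v p → Walk G u v (u ∷ p)

Connected : ∀ {n} → Graph n → Set
Connected {n} G = ∀ (u v : Fin n) → ∃ λ p → Walk G u v p

-- a cycle: distinct vertices v0,…,vk (k ≥ 2), consecutive ones adjacent, vk adjacent to v0
HasCycle : ∀ {n} → Graph n → Set
HasCycle {n} G = Σ (Fin n) λ u → Σ (Fin n) λ v → Σ (List (Fin n)) λ p →
  Walk G u v p × Unique p × 3 ≤ length p × Adj G v u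

IsTree : ∀ {n} → Graph n → Set
IsTree G = Connected G × ¬ HasCycle G

HasDist : ∀ {n} → Graph n → Fin n → Fin n → ℕ → Set
HasDist G u v k = (∃ λ p → Walk G u v p × length p ≡ suc k)
                × (∀ q → Walk G u v q → suc k ≤ length q)

Diam : ∀ {n} → Graph n → ℕ → Set
Diam {n} G d = (∀ (u v : Fin n) (k : ℕ) → HasDist G u v k → k ≤ d)
             × (Σ (Fin n) λ u → Σ (Fin n) λ v → HasDist G u v d)

degree : ∀ {n} → Graph n → Fin n → ℕ
degree G v = ∣ tabulate (G v) ∣

OnShortestPath : ∀ {n} → Graph n → Fin n → Fin n → Fin n → Set
OnShortestPath G u v w = ∃ λ p → Walk G u v p × (∀ q → Walk G u v q → length p ≤ length q)
                                  × w LM.∈ p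

InInterval : ∀ {n} → Graph n → Subset n → Fin n → Set
InInterval {n} G S w = Σ (Fin n) λ u → Σ (Fin n) λ v → u ∈ S × v ∈ S × OnShortestPath G u v w

IsGeodetic : ∀ {n} → Graph n → Subset n → Set
IsGeodetic {n} G S = ∀ (w : Fin n) → InInterval G S w

GeodeticNumber : ∀ {n} → Graph n → ℕ → Set
GeodeticNumber {n} G k = (∃ λ (S : Subset n) → IsGeodetic G S × ∣ S ∣ ≡ k)
                       × (∀ (S : Subset n) → IsGeodetic G S → k ≤ ∣ S ∣)

module Submission where

-- In the complement Tᶜ of a tree T, distinct vertices that are not adjacent in T are adjacent, while the ends
-- of an edge ab of T are at distance 2 if some vertex lies outside N[a] ∪ N[b], and at distance 3
-- otherwise (T has neither triangles nor 4-cycles).  So a vertex lies strictly inside a geodesic of Tᶜ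
-- only between the ends of an edge ab of T, and, when ab is not dominating, exactly when it is a common
-- non-neighbour of a and b.
-- If diam T ≤ 2 every edge dominates, so only V is geodetic.  If diam T = 3, the middle edge uv of a
-- diametral path s u v t dominates, and {u, v} is geodetic through the geodesics u t w v and v s w u.
-- If diam T ≥ 4 no edge dominates, and both a path x₀ x₁ x₂ x₃ and the closed neighbourhood of a
-- vertex of degree two are geodetic.  Conversely a geodetic set contains an edge (otherwise I(S) = S)
-- and a third vertex (a neighbour of that edge must be covered); with exactly three elements, covering
-- the remaining neighbours forces a vertex of degree two.

open import Defs
open import Data.Nat using (ℕ; suc; _≤_; _<_; z≤n; s≤s)
open import Data.Nat.Properties
  using (≤-refl; ≤-reflexive; ≤-trans; ≤-antisym; ≤-pred; <⇒≤; <⇒≱; n≤1+n; +-mono-≤; m+n≤o⇒n≤o)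
open import Data.Fin using (Fin; zero; suc)
open import Data.Fin.Properties using (any?) renaming (_≟_ to _≟ᶠ_)
open import Data.Fin.Subset using (Subset; ∣_∣; _∈_; _⊆_; ⁅_⁆; _∪_; ⊤; outside; inside)
  renaming (⊥ to ∅)
open import Data.Fin.Subset.Properties
  using (∣p∣≤∣x∷p∣; ∣⊥∣≡0; x∈⁅x⁆; x∈p∪q⁺; ∪-identityˡ;
         p⊆q⇒∣p∣≤∣q∣; x∈p⇒∣p-x∣<∣p∣; ∈⊤; ∣⊤∣≡n; x∈p∧x≢y⇒x∈p-y)
  renaming (_∈?_ to _∈ˢ?_)
open import Data.Vec using (_∷_; tabulate)
open import Data.Vec.Properties using (lookup∘tabulate; []=⇒lookup; lookup⇒[]=)
open import Data.Bool using (Bool; true; false)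
import Data.Bool as Bool
open import Data.List using (List; []; _∷_; length; foldr; _++_)
open import Data.List.Properties using (length-++)
open import Data.List.Membership.Propositional using () renaming (_∈_ to _∈ₗ_; _∉_ to _∉ₗ_)
open import Data.List.Relation.Unary.Any using (here; there)
import Data.List.Relation.Unary.Any as Any
open import Data.List.Relation.Unary.All using ([]; _∷_)
import Data.List.Relation.Unary.All as All
open import Data.List.Relation.Unary.All.Properties using (¬Any⇒All¬)
open import Data.List.Relation.Unary.Unique.Propositional using (Unique; []; _∷_)
open import Data.List.Relation.Unary.Unique.Propositional.Properties using (take⁺)
open import Data.Product using (Σ; _×_; _,_; proj₁; proj₂)
open import Data.Sum using (_⊎_; inj₁; inj₂)
import Data.Sum as Sum
open import Data.Empty using (⊥; ⊥-elim)
open import Function using (_∘_; case_of_)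
open import Relation.Binary.PropositionalEquality using (_≡_; _≢_; ≢-sym; refl; sym; trans; cong; subst)
open import Relation.Nullary using (¬_; Dec; yes; no; ¬?; _×-dec_; contradiction)

_∈ₗ?_ : ∀ {n} (x : Fin n) (l : List (Fin n)) → Dec (x ∈ₗ l)
x ∈ₗ? l = Any.any? (x ≟ᶠ_) l

∣⁅x⁆∪p∣≤1+∣p∣ : ∀ {n} (x : Fin n) (p : Subset n) → ∣ ⁅ x ⁆ ∪ p ∣ ≤ suc ∣ p ∣
∣⁅x⁆∪p∣≤1+∣p∣ zero    (s ∷ p) rewrite ∪-identityˡ p = s≤s (∣p∣≤∣x∷p∣ s p)
∣⁅x⁆∪p∣≤1+∣p∣ (suc x) (outside ∷ p) = ∣⁅x⁆∪p∣≤1+∣p∣ x p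
∣⁅x⁆∪p∣≤1+∣p∣ (suc x) (inside  ∷ p) = s≤s (∣⁅x⁆∪p∣≤1+∣p∣ x p)

module _ {n : ℕ} where

  fromList : List (Fin n) → Subset n
  fromList = foldr (λ x p → ⁅ x ⁆ ∪ p) ∅

  ∈fromList⁺ : ∀ {x} l → x ∈ₗ l → x ∈ fromList l
  ∈fromList⁺ _       (here refl) = x∈p∪q⁺ (inj₁ (x∈⁅x⁆ _))
  ∈fromList⁺ (_ ∷ l) (there m)   = x∈p∪q⁺ (inj₂ (∈fromList⁺ l m))

  ∣fromList∣≤length : ∀ l → ∣ fromList l ∣ ≤ length l
  ∣fromList∣≤length []      = ≤-reflexive (∣⊥∣≡0 n)
  ∣fromList∣≤length (x ∷ l) = ≤-trans (∣⁅x⁆∪p∣≤1+∣p∣ x (fromList l)) (s≤s (∣fromList∣≤length l))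

  Unique⇒length≤∣p∣ : ∀ {l} {p : Subset n} → Unique l → (∀ {x} → x ∈ₗ l → x ∈ p) → length l ≤ ∣ p ∣
  Unique⇒length≤∣p∣ {[]}    _          _   = z≤n
  Unique⇒length≤∣p∣ {x ∷ l} (x∉l ∷ ul) l⊆p =
    ≤-trans (s≤s (Unique⇒length≤∣p∣ ul (λ m → x∈p∧x≢y⇒x∈p-y (l⊆p (there m)) (All.lookup x∉l m ∘ sym))))
            (x∈p⇒∣p-x∣<∣p∣ (l⊆p (here refl)))

  pair≤∣S∣ : ∀ {S : Subset n} {p q} → p ∈ S → q ∈ S → p ≢ q → 2 ≤ ∣ S ∣
  pair≤∣S∣ p∈S q∈S p≢q = Unique⇒length≤∣p∣ ((p≢q ∷ []) ∷ [] ∷ []) λ { (here refl) → p∈S ; (there (here refl)) → q∈S }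

  ∣fromList∣≡length : ∀ {l} → Unique l → ∣ fromList l ∣ ≡ length l
  ∣fromList∣≡length {l} ul = ≤-antisym (∣fromList∣≤length l) (Unique⇒length≤∣p∣ ul (∈fromList⁺ l))

  ∈tabulate⁺ : ∀ {f : Fin n → Bool} {x} → f x ≡ true → x ∈ tabulate f
  ∈tabulate⁺ {f} {x} fx = lookup⇒[]= x (tabulate f) (trans (lookup∘tabulate f x) fx)

  ∈tabulate⁻ : ∀ {f : Fin n → Bool} {x} → x ∈ tabulate f → f x ≡ true
  ∈tabulate⁻ {f} {x} x∈f = trans (sym (lookup∘tabulate f x)) ([]=⇒lookup x∈f)

  ⊆list⊎∃∉ : ∀ (p : Subset n) l → (∀ {x} → x ∈ p → x ∈ₗ l) ⊎ Σ (Fin n) λ x → x ∈ p × x ∉ₗ l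
  ⊆list⊎∃∉ p l with any? (λ x → (x ∈ˢ? p) ×-dec ¬? (x ∈ₗ? l))
  ... | yes found = inj₂ found
  ... | no  none  = inj₁ p⊆l
    where
    p⊆l : ∀ {x} → x ∈ p → x ∈ₗ l
    p⊆l {x} x∈p with x ∈ₗ? l
    ... | yes x∈l = x∈l
    ... | no  x∉l = contradiction (x , x∈p , x∉l) none

  length<∣p∣⇒∃∉ : ∀ {l} {p : Subset n} → length l < ∣ p ∣ → Σ (Fin n) λ x → x ∈ p × x ∉ₗ l
  length<∣p∣⇒∃∉ {l} {p} l<p with ⊆list⊎∃∉ p l
  ... | inj₂ found = found
  ... | inj₁ p⊆l   = contradiction (≤-trans (p⊆q⇒∣p∣≤∣q∣ (∈fromList⁺ l ∘ p⊆l)) (∣fromList∣≤length l)) (<⇒≱ l<p)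

  ∣p∣≡2⇒pair : ∀ {p : Subset n} → ∣ p ∣ ≡ 2 →
               Σ (Fin n) λ a → Σ (Fin n) λ c → a ∈ p × c ∈ p × a ≢ c × (∀ {y} → y ∈ p → y ∈ₗ a ∷ c ∷ [])
  ∣p∣≡2⇒pair {p} ∣p∣≡2 with length<∣p∣⇒∃∉ {[]} (≤-trans (s≤s z≤n) (≤-reflexive (sym ∣p∣≡2)))
  ... | a , a∈p , _ with length<∣p∣⇒∃∉ {a ∷ []} (≤-reflexive (sym ∣p∣≡2))
  ... | c , c∈p , c∉a = a , c , a∈p , c∈p , a≢c , only-a-c
    where
    a≢c : a ≢ c
    a≢c a≡c = c∉a (here (sym a≡c))
    only-a-c : ∀ {y} → y ∈ p → y ∈ₗ a ∷ c ∷ []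
    only-a-c {y} y∈p with y ∈ₗ? (a ∷ c ∷ [])
    ... | yes y∈ac = y∈ac
    ... | no  y∉ac = contradiction (Unique⇒length≤∣p∣ (¬Any⇒All¬ _ y∉ac ∷ (a≢c ∷ []) ∷ [] ∷ []) ⊆p)
                                    (<⇒≱ (≤-reflexive (cong suc ∣p∣≡2)))
      where
      ⊆p : ∀ {x} → x ∈ₗ y ∷ a ∷ c ∷ [] → x ∈ p
      ⊆p (here refl)                 = y∈p
      ⊆p (there (here refl))         = a∈p
      ⊆p (there (there (here refl))) = c∈p

IsGeodesic : ∀ {n} → Graph n → Fin n → Fin n → List (Fin n) → Set
IsGeodesic G u v p = ∀ q → Walk G u v q → length p ≤ length q

record Path₄ {n} (G : Graph n) : Set where
  constructor path₄
  field
    x₀ x₁ x₂ x₃ : Fin n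
    x₀x₁ : Adj G x₀ x₁
    x₁x₂ : Adj G x₁ x₂
    x₂x₃ : Adj G x₂ x₃
    distinct : Unique (x₀ ∷ x₁ ∷ x₂ ∷ x₃ ∷ [])

module _ {n : ℕ} {G : Graph n} where

  walk-length≥1 : ∀ {u v p} → Walk G u v p → 1 ≤ length p
  walk-length≥1 here       = s≤s z≤n
  walk-length≥1 (step _ _) = s≤s z≤n

  walk-length≥2 : ∀ {u v p} → Walk G u v p → u ≢ v → 2 ≤ length p
  walk-length≥2 here       u≢v = contradiction refl u≢v
  walk-length≥2 (step _ w) _   = s≤s (walk-length≥1 w)

  nonadjacent⇒walk≥3 : ∀ {u x r} → Walk G u x r → x ≢ u → G u x ≡ false → 3 ≤ length r
  nonadjacent⇒walk≥3 here                x≢u _  = contradiction refl x≢u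
  nonadjacent⇒walk≥3 (step e here)       _   ux = contradiction (trans (sym e) ux) λ ()
  nonadjacent⇒walk≥3 (step _ (step _ w)) _   _  = s≤s (s≤s (walk-length≥1 w))

  walk-end∈ : ∀ {u v p} → Walk G u v p → v ∈ₗ p
  walk-end∈ here       = here refl
  walk-end∈ (step _ w) = there (walk-end∈ w)

  walk-++ : ∀ {x y z p q} → Walk G x y p → Walk G y z (y ∷ q) → Walk G x z (p ++ q)
  walk-++ here       w′ = w′
  walk-++ (step e w) w′ = step e (walk-++ w w′)

  path-suffix : ∀ {u v x p} → Walk G u v p → Unique p → x ∈ₗ p →
                Σ (List (Fin n)) λ r → Walk G x v r × Unique r × length r ≤ length p
  path-suffix here         up (here refl) = _ , here , up , ≤-refl
  path-suffix w@(step _ _) up (here refl) = _ , w , up , ≤-refl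
  path-suffix (step _ w) (_ ∷ up) (there x∈p) with path-suffix w up x∈p
  ... | r , wr , ur , r≤p = r , wr , ur , ≤-trans r≤p (n≤1+n _)

  path-prefix : ∀ {u v x p} → Walk G u v p → Unique p → x ∈ₗ p →
                Σ (List (Fin n)) λ r → Walk G u x r × Unique r × (∀ {z} → z ∈ₗ r → z ∈ₗ p)
  path-prefix here       _          (here refl) = _ , here , [] ∷ [] , λ z∈r → z∈r
  path-prefix (step _ _) _          (here refl) = _ , here , [] ∷ [] , λ { (here refl) → here refl }
  path-prefix (step e w) (u∉p ∷ up) (there x∈p) with path-prefix w up x∈p
  ... | r , wr , ur , r⊆p =
    _ , step e wr , All.tabulate (All.lookup u∉p ∘ r⊆p) ∷ ur ,
    λ { (here refl) → here refl ; (there z∈r) → there (r⊆p z∈r) }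

  walk⇒path : ∀ {u v p} → Walk G u v p → Σ (List (Fin n)) λ q → Walk G u v q × Unique q × length q ≤ length p
  walk⇒path here = _ , here , [] ∷ [] , ≤-refl
  walk⇒path {u} (step e w) with walk⇒path w
  ... | q , wq , uq , q≤p with u ∈ₗ? q
  ...   | no  u∉q = u ∷ q , step e wq , ¬Any⇒All¬ q u∉q ∷ uq , s≤s q≤p
  ...   | yes u∈q with path-suffix wq uq u∈q
  ...     | r , wr , ur , r≤q = r , wr , ur , ≤-trans r≤q (≤-trans q≤p (n≤1+n _))

  geodesic-no-shortcut : ∀ {u v x y q} → Walk G y v q → IsGeodesic G u v (u ∷ x ∷ q) → u ≢ y × ¬ Adj G u y
  geodesic-no-shortcut {v = v} w geo =
    (λ u≡y → <⇒≱ (n≤1+n _) (geo _ (subst (λ z → Walk G z v _) (sym u≡y) w))) ,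
    λ e → <⇒≱ ≤-refl (geo _ (step e w))

  ∈⇒InInterval : ∀ {S : Subset n} {w} → w ∈ S → InInterval G S w
  ∈⇒InInterval w∈S = _ , _ , w∈S , w∈S , _ , here , (λ _ → walk-length≥1) , here refl

  geodesic-loop : ∀ {u w} → OnShortestPath G u u w → w ≡ u
  geodesic-loop (_ , here     , _   , here w≡u) = w≡u
  geodesic-loop (_ , step _ w , geo , _)        = contradiction (geo _ here) (<⇒≱ (s≤s (walk-length≥1 w)))

  interval-element : ∀ {S : Subset n} {w} → InInterval G S w →
                     w ∈ S ⊎ Σ (Fin n) λ p → Σ (Fin n) λ q → p ∈ S × q ∈ S × p ≢ q
  interval-element (p , q , p∈S , q∈S , osp) with p ≟ᶠ q
  ... | yes refl = inj₁ (subst (_∈ _) (sym (geodesic-loop osp)) p∈S)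
  ... | no  p≢q  = inj₂ (p , q , p∈S , q∈S , p≢q)

  geodetic⇒2≤∣S∣ : ∀ {S : Subset n} {u v} → IsGeodetic G S → u ≢ v → 2 ≤ ∣ S ∣
  geodetic⇒2≤∣S∣ {u = u} {v} geo u≢v with interval-element (geo u) | interval-element (geo v)
  ... | inj₂ (p , q , p∈S , q∈S , p≢q) | _ = pair≤∣S∣ p∈S q∈S p≢q
  ... | inj₁ _   | inj₂ (p , q , p∈S , q∈S , p≢q) = pair≤∣S∣ p∈S q∈S p≢q
  ... | inj₁ u∈S | inj₁ v∈S = pair≤∣S∣ u∈S v∈S u≢v

  distance⇒path : ∀ {u v k} → HasDist G u v k → Σ (List (Fin n)) λ p → Walk G u v p × Unique p × length p ≡ suc k
  distance⇒path ((p , w , p≡k) , minimal) with walk⇒path w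
  ... | q , wq , uq , q≤p = q , wq , uq , ≤-antisym (≤-trans q≤p (≤-reflexive p≡k)) (minimal q wq)

  diameter≥3⇒path₄ : ∀ {d} → Diam G d → 3 ≤ d → Path₄ G
  diameter≥3⇒path₄ (_ , _ , _ , dist) 3≤d with distance⇒path dist
  ... | _ , w , up , p≡d = first-four w up (≤-trans (s≤s 3≤d) (≤-reflexive (sym p≡d)))
    where
    first-four : ∀ {s t p} → Walk G s t p → Unique p → 4 ≤ length p → Path₄ G
    first-four (step e₀ (step e₁ (step e₂ here)))       up _ = path₄ _ _ _ _ e₀ e₁ e₂ up
    first-four (step e₀ (step e₁ (step e₂ (step _ _)))) up _ = path₄ _ _ _ _ e₀ e₁ e₂ (take⁺ 4 up)
    first-four here                     _ (s≤s ())
    first-four (step _ here)            _ (s≤s (s≤s ()))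
    first-four (step _ (step _ here))   _ (s≤s (s≤s (s≤s ())))

adjacency : ∀ {n} (G : Graph n) (a b : Fin n) → Adj G a b ⊎ G a b ≡ false
adjacency G a b with G a b
... | true  = inj₁ refl
... | false = inj₂ refl

module Adjacency {n : ℕ} (G : Graph n) where

  nonadj⇒¬adj : ∀ {a b} → G a b ≡ false → ¬ Adj G a b
  nonadj⇒¬adj ab′ ab = contradiction (trans (sym ab′) ab) λ ()

  ¬adj⇒nonadj : ∀ {a b} → ¬ Adj G a b → G a b ≡ false
  ¬adj⇒nonadj {a} {b} ¬ab with adjacency G a b
  ... | inj₁ ab  = contradiction ab ¬ab
  ... | inj₂ ab′ = ab′

  adj-nonadj⇒≢ : ∀ {a p y} → Adj G a y → G p y ≡ false → a ≢ p
  adj-nonadj⇒≢ ay py′ refl = nonadj⇒¬adj py′ ay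

module Complement {n : ℕ} (G : Graph n) where

  complement-adj⁺ : ∀ {a b} → G a b ≡ false → a ≢ b → Adj (complement G) a b
  complement-adj⁺ {a} {b} ab a≢b with a ≟ᶠ b
  ... | yes a≡b = contradiction a≡b a≢b
  ... | no  _   rewrite ab = refl

  complement-adj⁻ : ∀ {a b} → Adj (complement G) a b → G a b ≡ false × a ≢ b
  complement-adj⁻ {a} {b} e with G a b | a ≟ᶠ b
  complement-adj⁻ () | true  | _
  complement-adj⁻ () | false | yes _
  ... | false | no a≢b = refl , a≢b

  complement-nonadj : ∀ {a b} → ¬ Adj (complement G) a b → a ≢ b → Adj G a b
  complement-nonadj {a} {b} ¬ab a≢b with adjacency G a b
  ... | inj₁ ab  = ab
  ... | inj₂ ab′ = contradiction (complement-adj⁺ ab′ a≢b) ¬ab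

module _ {n : ℕ} {G : Graph n} {a b : Fin n} where

  walk-leaving-pair : ∀ {x z q} → Walk G x z q → x ≡ a ⊎ x ≡ b → z ≢ a → z ≢ b →
                      Σ (Fin n) λ y → (Adj G a y ⊎ Adj G b y) × y ≢ a × y ≢ b
  walk-leaving-pair here (inj₁ refl) z≢a _ = contradiction refl z≢a
  walk-leaving-pair here (inj₂ refl) _ z≢b = contradiction refl z≢b
  walk-leaving-pair (step {w = y} e w) x∈ab z≢a z≢b with y ≟ᶠ a | y ≟ᶠ b
  ... | yes y≡a | _       = walk-leaving-pair w (inj₁ y≡a) z≢a z≢b
  ... | no  _   | yes y≡b = walk-leaving-pair w (inj₂ y≡b) z≢a z≢b
  ... | no  y≢a | no  y≢b = y , Sum.map (λ { refl → e }) (λ { refl → e }) x∈ab , y≢a , y≢b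

CommonNonNeighbour : ∀ {n} → Graph n → Fin n → Fin n → Fin n → Set
CommonNonNeighbour G a b x = x ≢ a × x ≢ b × G a x ≡ false × G b x ≡ false

Dominating : ∀ {n} → Graph n → Fin n → Fin n → Set
Dominating G a b = ∀ x → ¬ CommonNonNeighbour G a b x

module _ {n : ℕ} {G : Graph n} {a b : Fin n} where

  ¬dominating⇒commonNonNeighbour : ¬ Dominating G a b → Σ (Fin n) (CommonNonNeighbour G a b)
  ¬dominating⇒commonNonNeighbour ¬dom
    with any? (λ x → ¬? (x ≟ᶠ a) ×-dec ¬? (x ≟ᶠ b) ×-dec (G a x Bool.≟ false) ×-dec (G b x Bool.≟ false))
  ... | yes found = found
  ... | no  none  = contradiction (λ x cnn → none (x , cnn)) ¬dom

  dominating-sym : Dominating G a b → Dominating G b a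
  dominating-sym dom x (x≢b , x≢a , bx′ , ax′) = dom x (x≢a , x≢b , ax′ , bx′)

  dominated : Dominating G a b → ∀ x → x ≡ a ⊎ x ≡ b ⊎ Adj G a x ⊎ Adj G b x
  dominated dom x with x ≟ᶠ a | x ≟ᶠ b | adjacency G a x | adjacency G b x
  ... | yes x≡a | _       | _       | _       = inj₁ x≡a
  ... | no  _   | yes x≡b | _       | _       = inj₂ (inj₁ x≡b)
  ... | no  _   | no  _   | inj₁ ax | _       = inj₂ (inj₂ (inj₁ ax))
  ... | no  _   | no  _   | inj₂ _  | inj₁ bx = inj₂ (inj₂ (inj₂ bx))
  ... | no  x≢a | no  x≢b | inj₂ ax | inj₂ bx = contradiction (x≢a , x≢b , ax , bx) (dom x)

module SimpleGraph {n : ℕ} {G : Graph n} (simple : IsSimple G) where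

  open Adjacency G public
  open Complement G public

  Gᶜ : Graph n
  Gᶜ = complement G

  adj-sym : ∀ {a b} → Adj G a b → Adj G b a
  adj-sym {a} {b} ab = trans (proj₁ simple b a) ab

  nonadj-sym : ∀ {a b} → G a b ≡ false → G b a ≡ false
  nonadj-sym {a} {b} ab = trans (proj₁ simple b a) ab

  adj⇒≢ : ∀ {a b} → Adj G a b → a ≢ b
  adj⇒≢ {a} ab refl = nonadj⇒¬adj (proj₂ simple a) ab

  dominating-edge⇒distance≤3 : ∀ {a b x y k} → Adj G a b → Dominating G a b → HasDist G x y k → k ≤ 3
  dominating-edge⇒distance≤3 {a} {b} {x} {y} ab dom (_ , minimal) with short-walk
    where
    to-edge : (Σ (List (Fin n)) λ p → Walk G x a p × length p ≤ 2)
            ⊎ (Σ (List (Fin n)) λ p → Walk G x b p × length p ≤ 2)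
    to-edge with dominated dom x
    ... | inj₁ refl             = inj₁ (_ , here , s≤s z≤n)
    ... | inj₂ (inj₁ refl)      = inj₂ (_ , here , s≤s z≤n)
    ... | inj₂ (inj₂ (inj₁ ax)) = inj₁ (_ , step (adj-sym ax) here , ≤-refl)
    ... | inj₂ (inj₂ (inj₂ bx)) = inj₂ (_ , step (adj-sym bx) here , ≤-refl)
    from-edge : (Σ (List (Fin n)) λ q → Walk G a y (a ∷ q) × length q ≤ 1)
              ⊎ (Σ (List (Fin n)) λ q → Walk G b y (b ∷ q) × length q ≤ 1)
    from-edge with dominated dom y
    ... | inj₁ refl             = inj₁ (_ , here , z≤n)
    ... | inj₂ (inj₁ refl)      = inj₂ (_ , here , z≤n)
    ... | inj₂ (inj₂ (inj₁ ay)) = inj₁ (_ , step ay here , ≤-refl)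
    ... | inj₂ (inj₂ (inj₂ by)) = inj₂ (_ , step by here , ≤-refl)
    join : ∀ {e p q} → Walk G x e p → length p ≤ 2 → Walk G e y (e ∷ q) → length q ≤ 2 →
           Σ (List (Fin n)) λ r → Walk G x y r × length r ≤ 4
    join {p = p} xe p≤2 ey q≤2 = _ , walk-++ xe ey , ≤-trans (≤-reflexive (length-++ p)) (+-mono-≤ p≤2 q≤2)
    short-walk : Σ (List (Fin n)) λ r → Walk G x y r × length r ≤ 4
    short-walk with to-edge | from-edge
    ... | inj₁ (_ , xa , p≤2) | inj₁ (_ , ay , q≤1) = join xa p≤2 ay (≤-trans q≤1 (n≤1+n 1))
    ... | inj₁ (_ , xa , p≤2) | inj₂ (_ , by , q≤1) = join xa p≤2 (step ab by) (s≤s q≤1)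
    ... | inj₂ (_ , xb , p≤2) | inj₁ (_ , ay , q≤1) = join xb p≤2 (step (adj-sym ab) ay) (s≤s q≤1)
    ... | inj₂ (_ , xb , p≤2) | inj₂ (_ , by , q≤1) = join xb p≤2 by (≤-trans q≤1 (n≤1+n 1))
  ... | _ , xy , r≤4 = ≤-pred (≤-trans (minimal _ xy) r≤4)

  complement-common-neighbour : ∀ {a b x} → Adj Gᶜ a x → Adj Gᶜ x b → CommonNonNeighbour G a b x
  complement-common-neighbour ax xb with complement-adj⁻ ax | complement-adj⁻ xb
  ... | ax′ , a≢x | xb′ , x≢b = ≢-sym a≢x , x≢b , ax′ , nonadj-sym xb′

  commonNonNeighbour⇒complement-path : ∀ {a b x} → CommonNonNeighbour G a b x → Adj Gᶜ a x × Adj Gᶜ x b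
  commonNonNeighbour⇒complement-path (x≢a , x≢b , ax′ , bx′) =
    complement-adj⁺ ax′ (≢-sym x≢a) , complement-adj⁺ (nonadj-sym bx′) x≢b

  edge⇒complement-walk≥3 : ∀ {a b q} → Adj G a b → Walk Gᶜ a b q → 3 ≤ length q
  edge⇒complement-walk≥3 ab here                = contradiction refl (adj⇒≢ ab)
  edge⇒complement-walk≥3 ab (step e here)       = contradiction ab (nonadj⇒¬adj (proj₁ (complement-adj⁻ e)))
  edge⇒complement-walk≥3 ab (step _ (step _ w)) = s≤s (s≤s (walk-length≥1 w))

  dominating-edge⇒complement-walk≥4 : ∀ {a b q} → Adj G a b → Dominating G a b → Walk Gᶜ a b q → 4 ≤ length q
  dominating-edge⇒complement-walk≥4 ab _   w@here        = contradiction (edge⇒complement-walk≥3 ab w) λ { (s≤s ()) }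
  dominating-edge⇒complement-walk≥4 ab _   w@(step _ here) =
    contradiction (edge⇒complement-walk≥3 ab w) λ { (s≤s (s≤s ())) }
  dominating-edge⇒complement-walk≥4 _  dom (step az (step zb here)) =
    contradiction (complement-common-neighbour az zb) (dom _)
  dominating-edge⇒complement-walk≥4 _  _   (step _ (step _ (step _ w))) = s≤s (s≤s (s≤s (walk-length≥1 w)))

  commonNonNeighbour⇒on-geodesic : ∀ {a b w} → Adj G a b → CommonNonNeighbour G a b w → OnShortestPath Gᶜ a b w
  commonNonNeighbour⇒on-geodesic ab cnn with commonNonNeighbour⇒complement-path cnn
  ... | aw , wb = _ , step aw (step wb here) , (λ _ → edge⇒complement-walk≥3 ab) , there (here refl)

  dominating-edges⇒interval-trivial : (∀ {a b} → Adj G a b → Dominating G a b) →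
                                      ∀ {u v w} → OnShortestPath Gᶜ u v w → w ≡ u ⊎ w ≡ v
  dominating-edges⇒interval-trivial _   (_ , here       , _ , here w≡u) = inj₁ w≡u
  dominating-edges⇒interval-trivial _   (_ , here       , _ , there ())
  dominating-edges⇒interval-trivial _   (_ , step _ _   , _ , here w≡u) = inj₁ w≡u
  dominating-edges⇒interval-trivial _   (_ , step _ here , _ , there (here w≡v)) = inj₂ w≡v
  dominating-edges⇒interval-trivial _   (_ , step _ here , _ , there (there ()))
  dominating-edges⇒interval-trivial dom (_ , step ux (step {u = x} xy w) , geo , there _)
    with geodesic-no-shortcut {x = x} w geo
  ... | u≢y , ¬uy = contradiction (complement-common-neighbour ux xy) (dom (complement-nonadj ¬uy u≢y) _)

  CoveredByEdgeOf : Subset n → Fin n → Set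
  CoveredByEdgeOf S w = Σ (Fin n) λ p → Σ (Fin n) λ q → p ∈ S × q ∈ S × Adj G p q × CommonNonNeighbour G p q w

  module _ (no-dominating-edge : ∀ {a b} → Adj G a b → ¬ Dominating G a b) where

    complement-walk≤3 : ∀ u v → Σ (List (Fin n)) λ q → Walk Gᶜ u v q × length q ≤ 3
    complement-walk≤3 u v with u ≟ᶠ v | adjacency G u v
    ... | yes refl | _        = _ , here , s≤s z≤n
    ... | no  u≢v  | inj₂ uv′ = _ , step (complement-adj⁺ uv′ u≢v) here , s≤s (s≤s z≤n)
    ... | no  _    | inj₁ uv  with ¬dominating⇒commonNonNeighbour (no-dominating-edge uv)
    ...   | _ , cnn with commonNonNeighbour⇒complement-path cnn
    ...     | uz , zv = _ , step uz (step zv here) , ≤-refl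

    geodesic-shape : ∀ {u v w} → OnShortestPath Gᶜ u v w → w ≡ u ⊎ w ≡ v ⊎ (Adj G u v × CommonNonNeighbour G u v w)
    geodesic-shape (_ , here                     , _ , here w≡u)              = inj₁ w≡u
    geodesic-shape (_ , here                     , _ , there ())
    geodesic-shape (_ , step _ _                 , _ , here w≡u)              = inj₁ w≡u
    geodesic-shape (_ , step _ here              , _ , there (here w≡v))      = inj₂ (inj₁ w≡v)
    geodesic-shape (_ , step _ here              , _ , there (there ()))
    geodesic-shape (_ , step _ (step _ here)     , _ , there (there (here w≡v))) = inj₂ (inj₁ w≡v)
    geodesic-shape (_ , step _ (step _ here)     , _ , there (there (there ())))
    geodesic-shape (_ , step ux (step {u = x} xv here) , geo , there (here refl))
      with geodesic-no-shortcut {x = x} here geo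
    ... | u≢v , ¬uv = inj₂ (inj₂ (complement-nonadj ¬uv u≢v , complement-common-neighbour ux xv))
    geodesic-shape {u} {v} (_ , step _ (step _ (step _ w)) , geo , _) with complement-walk≤3 u v
    ... | q , wq , q≤3 = contradiction (≤-trans (geo q wq) q≤3) (<⇒≱ (s≤s (s≤s (s≤s (walk-length≥1 w)))))

    geodetic-cover : ∀ {S} → IsGeodetic Gᶜ S → ∀ w → w ∈ S ⊎ CoveredByEdgeOf S w
    geodetic-cover geo w with geo w
    ... | p , q , p∈S , q∈S , osp with geodesic-shape osp
    ...   | inj₁ refl               = inj₁ p∈S
    ...   | inj₂ (inj₁ refl)        = inj₁ q∈S
    ...   | inj₂ (inj₂ (pq , cnn)) = inj₂ (p , q , p∈S , q∈S , pq , cnn)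

  dominating-edges⇒geodetic-full : (∀ {a b} → Adj G a b → Dominating G a b) →
                                   ∀ {S} → IsGeodetic Gᶜ S → ∀ w → w ∈ S
  dominating-edges⇒geodetic-full dom geo w with geo w
  ... | _ , _ , p∈S , q∈S , osp with dominating-edges⇒interval-trivial dom osp
  ...   | inj₁ refl = p∈S
  ...   | inj₂ refl = q∈S

  diameter>3⇒no-dominating-edge : ∀ {d} → Diam G d → 3 < d → ∀ {a b} → Adj G a b → ¬ Dominating G a b
  diameter>3⇒no-dominating-edge (_ , _ , _ , dist) 3<d ab dom = <⇒≱ 3<d (dominating-edge⇒distance≤3 ab dom dist)

module Tree {n : ℕ} {T : Graph n} (simple : IsSimple T) (tree : IsTree T) where

  open SimpleGraph simple public

  cycle : ∀ {a b c r} → Walk T a b r → Unique (c ∷ r) → Adj T c a → Adj T b c → a ≢ b → ⊥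
  cycle wr ucr ca bc a≢b = proj₂ tree (_ , _ , _ , step ca wr , ucr , s≤s (walk-length≥2 wr a≢b) , bc)

  no-triangle : ∀ {a b c} → Adj T a b → Adj T b c → Adj T c a → ⊥
  no-triangle ab bc ca =
    cycle (step bc here) ((adj⇒≢ ab ∷ ≢-sym (adj⇒≢ ca) ∷ []) ∷ (adj⇒≢ bc ∷ []) ∷ [] ∷ []) ab ca (adj⇒≢ bc)

  no-square : ∀ {a b c d} → Adj T a b → Adj T b c → Adj T c d → Adj T d a → a ≢ c → b ≢ d → ⊥
  no-square ab bc cd da a≢c b≢d =
    cycle (step bc (step cd here))
          ((adj⇒≢ ab ∷ a≢c ∷ ≢-sym (adj⇒≢ da) ∷ []) ∷ (adj⇒≢ bc ∷ b≢d ∷ []) ∷ (adj⇒≢ cd ∷ []) ∷ [] ∷ [])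
          ab da b≢d

  head-has-no-chord : ∀ {a y c r b} → Walk T a y r → Unique (c ∷ r) → Adj T c a → b ∈ₗ r → Adj T b c → a ≢ b → ⊥
  head-has-no-chord wr (c∉r ∷ ur) ca b∈r bc a≢b with path-prefix wr ur b∈r
  ... | _ , wr′ , ur′ , r′⊆r = cycle wr′ (All.tabulate (All.lookup c∉r ∘ r′⊆r) ∷ ur′) ca bc a≢b

  path-extend : ∀ {a y c r b} → Walk T a y r → Unique (c ∷ r) → Adj T c a → Adj T b c → b ≢ a → Unique (b ∷ c ∷ r)
  path-extend {r = r} wr ucr ca bc b≢a =
    (adj⇒≢ bc ∷ ¬Any⇒All¬ r (λ b∈r → head-has-no-chord wr ucr ca b∈r bc (≢-sym b≢a))) ∷ ucr

  -- A walk leaving x through a neighbour b other than the next vertex of the path extends the path to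
  -- the path b x …, which the rest of the walk is then compared with.
  path⇒geodesic : ∀ {x y p} → Walk T x y p → Unique p → IsGeodesic T x y p
  path⇒geodesic here _ _ wq = walk-length≥1 wq
  path⇒geodesic (step _ wp) (x∉p ∷ _) _ here = contradiction refl (All.lookup x∉p (walk-end∈ wp))
  path⇒geodesic {p = _ ∷ p} (step {w = a} xa wp) up@(_ ∷ up′) _ (step {w = b} xb wq) with b ≟ᶠ a
  ... | yes refl = s≤s (path⇒geodesic wp up′ _ wq)
  ... | no  b≢a  =
    s≤s (m+n≤o⇒n≤o 2 (path⇒geodesic (step (adj-sym xb) (step xa wp)) (path-extend wp up xa (adj-sym xb) b≢a) _ wq))

  path⇒distance : ∀ {x y p} → Walk T x y (x ∷ p) → Unique (x ∷ p) → HasDist T x y (length p)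
  path⇒distance w u = (_ , w , refl) , path⇒geodesic w u

  path-between : ∀ u v → Σ (List (Fin n)) λ p → Walk T u v p × Unique p
  path-between u v with walk⇒path (proj₂ (proj₁ tree u v))
  ... | p , w , up , _ = p , w , up

  LongPathVia : Fin n → Fin n → Fin n → Set
  LongPathVia a b x = Σ (List (Fin n)) λ r → Walk T b x r × Unique (a ∷ r) × 3 ≤ length r

  commonNonNeighbour⇒long-path : ∀ {u v x} → Adj T u v → CommonNonNeighbour T u v x →
                                 LongPathVia u v x ⊎ LongPathVia v u x
  commonNonNeighbour⇒long-path {u} {v} {x} uv (x≢u , x≢v , ux , vx) with path-between u x
  ... | _ , here , _ = contradiction refl x≢u
  ... | _ , wr@(step {w = a} ua wr′) , ur with a ≟ᶠ v
  ...   | yes refl = inj₁ (_ , wr′ , ur , nonadjacent⇒walk≥3 wr′ x≢v vx)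
  ...   | no  a≢v  = inj₂ (_ , wr , path-extend wr′ ur ua (adj-sym uv) (≢-sym a≢v) , nonadjacent⇒walk≥3 wr x≢u ux)

  distance≤2⇒edge-dominating : (∀ a b k → HasDist T a b k → k ≤ 2) → ∀ {u v} → Adj T u v → Dominating T u v
  distance≤2⇒edge-dominating bound uv _ cnn with commonNonNeighbour⇒long-path uv cnn
  ... | inj₁ (_ , w , ur , 3≤r) = <⇒≱ 3≤r (bound _ _ _ (path⇒distance (step uv w) ur))
  ... | inj₂ (_ , w , ur , 3≤r) = <⇒≱ 3≤r (bound _ _ _ (path⇒distance (step (adj-sym uv) w) ur))

  distance≤3⇒middle-edge-dominating : (∀ a b k → HasDist T a b k → k ≤ 3) →
    ∀ {s u v t} → Adj T s u → Adj T u v → Adj T v t → s ≢ v → t ≢ u → Dominating T u v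
  distance≤3⇒middle-edge-dominating bound su uv vt s≢v t≢u _ cnn with commonNonNeighbour⇒long-path uv cnn
  ... | inj₁ (_ , w , ur , 3≤r) =
    <⇒≱ (s≤s 3≤r) (bound _ _ _ (path⇒distance (step su (step uv w)) (path-extend w ur uv su s≢v)))
  ... | inj₂ (_ , w , ur , 3≤r) =
    <⇒≱ (s≤s 3≤r) (bound _ _ _ (path⇒distance (step (adj-sym vt) (step (adj-sym uv) w))
                                               (path-extend w ur (adj-sym uv) (adj-sym vt) t≢u)))

  dominating-edge-cover : ∀ {a b c w} → Adj T a b → Dominating T a b → Adj T c b → c ≢ a → Adj T a w → w ≢ b →
                          OnShortestPath Gᶜ a b w
  dominating-edge-cover {a} {b} {c} {w} ab dom cb c≢a aw w≢b =
    _ , step ac (step cw (step wb here)) , (λ _ → dominating-edge⇒complement-walk≥4 ab dom) , there (there (here refl))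
    where
    ac′ : T a c ≡ false
    ac′ = ¬adj⇒nonadj λ ac → no-triangle ab (adj-sym cb) (adj-sym ac)
    ac : Adj Gᶜ a c
    ac = complement-adj⁺ ac′ (≢-sym c≢a)
    cw : Adj Gᶜ c w
    cw = complement-adj⁺ (¬adj⇒nonadj λ cw → no-square aw (adj-sym cw) cb (adj-sym ab) (≢-sym c≢a) w≢b)
                         (λ c≡w → nonadj⇒¬adj ac′ (subst (Adj T a) (sym c≡w) aw))
    wb : Adj Gᶜ w b
    wb = complement-adj⁺ (¬adj⇒nonadj λ wb → no-triangle aw wb (adj-sym ab)) w≢b

  degree-two⇒geodetic-triple : ∀ {b} → degree T b ≡ 2 → Σ (Subset n) λ S → IsGeodetic Gᶜ S × ∣ S ∣ ≡ 3
  degree-two⇒geodetic-triple {b} deg with ∣p∣≡2⇒pair deg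
  ... | a , c , a∈N , c∈N , a≢c , only-a-c =
    fromList L , geo , ∣fromList∣≡length ((≢-sym (adj⇒≢ ba) ∷ a≢c ∷ []) ∷ (adj⇒≢ bc ∷ []) ∷ [] ∷ [])
    where
    L : List (Fin n)
    L = a ∷ b ∷ c ∷ []
    ba : Adj T b a
    ba = ∈tabulate⁻ a∈N
    bc : Adj T b c
    bc = ∈tabulate⁻ c∈N
    non-neighbour : ∀ {w} → w ≢ a → w ≢ c → T b w ≡ false
    non-neighbour w≢a w≢c = ¬adj⇒nonadj λ bw → case only-a-c (∈tabulate⁺ bw) of λ
      { (here w≡a) → w≢a w≡a ; (there (here w≡c)) → w≢c w≡c }
    cover : ∀ {w} → w ≢ a → w ≢ b → w ≢ c → InInterval Gᶜ (fromList L) w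
    cover {w} w≢a w≢b w≢c with adjacency T a w
    ... | inj₂ aw′ = a , b , ∈fromList⁺ L (here refl) , ∈fromList⁺ L (there (here refl)) ,
                     commonNonNeighbour⇒on-geodesic (adj-sym ba) (w≢a , w≢b , aw′ , non-neighbour w≢a w≢c)
    ... | inj₁ aw  = c , b , ∈fromList⁺ L (there (there (here refl))) , ∈fromList⁺ L (there (here refl)) ,
                     commonNonNeighbour⇒on-geodesic (adj-sym bc) (w≢c , w≢b , cw′ , non-neighbour w≢a w≢c)
      where
      cw′ : T c w ≡ false
      cw′ = ¬adj⇒nonadj λ cw → no-square aw (adj-sym cw) (adj-sym bc) ba a≢c w≢b
    geo : IsGeodetic Gᶜ (fromList L)
    geo w with w ∈ₗ? L
    ... | yes w∈L = ∈⇒InInterval (∈fromList⁺ L w∈L)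
    ... | no  w∉L = cover (w∉L ∘ here) (w∉L ∘ there ∘ here) (w∉L ∘ there ∘ there ∘ here)

  path₄⇒geodetic-quadruple : Path₄ T → Σ (Subset n) λ S → IsGeodetic Gᶜ S × ∣ S ∣ ≡ 4
  path₄⇒geodetic-quadruple
    (path₄ x₀ x₁ x₂ x₃ e₀₁ e₁₂ e₂₃ distinct@((_ ∷ x₀≢x₂ ∷ _ ∷ []) ∷ (_ ∷ x₁≢x₃ ∷ []) ∷ _ ∷ [] ∷ [])) =
    fromList L , geo , ∣fromList∣≡length distinct
    where
    L : List (Fin n)
    L = x₀ ∷ x₁ ∷ x₂ ∷ x₃ ∷ []
    covered : ∀ {p q w} → p ∈ₗ L → q ∈ₗ L → Adj T p q → CommonNonNeighbour T p q w → InInterval Gᶜ (fromList L) w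
    covered p∈L q∈L pq cnn = _ , _ , ∈fromList⁺ L p∈L , ∈fromList⁺ L q∈L , commonNonNeighbour⇒on-geodesic pq cnn
    cover : ∀ {w} → w ≢ x₀ → w ≢ x₁ → w ≢ x₂ → w ≢ x₃ → InInterval Gᶜ (fromList L) w
    cover {w} w≢x₀ w≢x₁ w≢x₂ w≢x₃ with adjacency T x₁ w | adjacency T x₀ w
    ... | inj₂ x₁w′ | inj₂ x₀w′ = covered (here refl) (there (here refl)) e₀₁ (w≢x₀ , w≢x₁ , x₀w′ , x₁w′)
    ... | inj₂ x₁w′ | inj₁ x₀w  =
      covered (there (here refl)) (there (there (here refl))) e₁₂ (w≢x₁ , w≢x₂ , x₁w′ , x₂w′)
      where
      x₂w′ : T x₂ w ≡ false
      x₂w′ = ¬adj⇒nonadj λ x₂w → no-square e₀₁ e₁₂ x₂w (adj-sym x₀w) x₀≢x₂ (≢-sym w≢x₁)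
    ... | inj₁ x₁w  | _         = covered (there (there (here refl))) (there (there (there (here refl)))) e₂₃
                                          (w≢x₂ , w≢x₃ , x₂w′ , x₃w′)
      where
      x₂w′ : T x₂ w ≡ false
      x₂w′ = ¬adj⇒nonadj λ x₂w → no-triangle x₁w (adj-sym x₂w) (adj-sym e₁₂)
      x₃w′ : T x₃ w ≡ false
      x₃w′ = ¬adj⇒nonadj λ x₃w → no-square x₁w (adj-sym x₃w) (adj-sym e₂₃) (adj-sym e₁₂) x₁≢x₃ w≢x₂
    geo : IsGeodetic Gᶜ (fromList L)
    geo w with w ∈ₗ? L
    ... | yes w∈L = ∈⇒InInterval (∈fromList⁺ L w∈L)
    ... | no  w∉L =
      cover (w∉L ∘ here) (w∉L ∘ there ∘ here) (w∉L ∘ there ∘ there ∘ here) (w∉L ∘ there ∘ there ∘ there ∘ here)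

  EdgeAndThird : Subset n → Set
  EdgeAndThird S = Σ (Fin n) λ a → Σ (Fin n) λ b → Σ (Fin n) λ c →
                   a ∈ S × b ∈ S × c ∈ S × Adj T a b × c ≢ a × c ≢ b

  edgeAndThird⇒3≤∣S∣ : ∀ {S} → EdgeAndThird S → 3 ≤ ∣ S ∣
  edgeAndThird⇒3≤∣S∣ (_ , _ , _ , a∈S , b∈S , c∈S , ab , c≢a , c≢b) =
    Unique⇒length≤∣p∣ ((adj⇒≢ ab ∷ ≢-sym c≢a ∷ []) ∷ (≢-sym c≢b ∷ []) ∷ [] ∷ [])
      λ { (here refl) → a∈S ; (there (here refl)) → b∈S ; (there (there (here refl))) → c∈S }

  full⇒4≤∣S∣ : Path₄ T → ∀ {S : Subset n} → (∀ w → w ∈ S) → 4 ≤ ∣ S ∣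
  full⇒4≤∣S∣ (path₄ _ _ _ _ _ _ _ distinct) full = Unique⇒length≤∣p∣ distinct (λ _ → full _)

  module _ (no-dominating-edge : ∀ {a b} → Adj T a b → ¬ Dominating T a b) where

    edge⇒outer-neighbour : ∀ {a b} → Adj T a b → Σ (Fin n) λ y → (Adj T a y ⊎ Adj T b y) × y ≢ a × y ≢ b
    edge⇒outer-neighbour {a} {b} ab with ¬dominating⇒commonNonNeighbour (no-dominating-edge ab)
    ... | z , z≢a , z≢b , _ = walk-leaving-pair (proj₂ (proj₁ tree a z)) (inj₁ refl) z≢a z≢b

    geodetic⇒edgeAndThird⊎full : ∀ {S} → IsGeodetic Gᶜ S → EdgeAndThird S ⊎ (∀ w → w ∈ S)
    geodetic⇒edgeAndThird⊎full {S} geo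
      with any? (λ a → any? (λ b → (a ∈ˢ? S) ×-dec (b ∈ˢ? S) ×-dec (T a b Bool.≟ true)))
    ... | no none = inj₂ λ w → case geodetic-cover no-dominating-edge geo w of λ
      { (inj₁ w∈S) → w∈S
      ; (inj₂ (p , q , p∈S , q∈S , pq , _)) → contradiction (p , q , p∈S , q∈S , pq) none }
    ... | yes (a , b , a∈S , b∈S , ab) with edge⇒outer-neighbour ab
    ...   | y , ay⊎by , y≢a , y≢b with geodetic-cover no-dominating-edge geo y
    ...     | inj₁ y∈S = inj₁ (a , b , y , a∈S , b∈S , y∈S , ab , y≢a , y≢b)
    ...     | inj₂ (p , q , p∈S , q∈S , pq , _ , _ , py′ , qy′) with ay⊎by
    ...       | inj₁ ay = inj₁ (p , q , a , p∈S , q∈S , a∈S , pq , adj-nonadj⇒≢ ay py′ , adj-nonadj⇒≢ ay qy′)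
    ...       | inj₂ by = inj₁ (p , q , b , p∈S , q∈S , b∈S , pq , adj-nonadj⇒≢ by py′ , adj-nonadj⇒≢ by qy′)

    centre⇒degree-two : ∀ {S x y₁ y₂} → IsGeodetic Gᶜ S → (∀ {e} → e ∈ S → e ≢ x → e ∈ₗ y₁ ∷ y₂ ∷ []) →
                        Adj T x y₁ → Adj T x y₂ → y₁ ≢ y₂ → degree T x ≡ 2
    centre⇒degree-two {x = x} {y₁} {y₂} geo S⊆ xy₁ xy₂ y₁≢y₂ =
      ≤-antisym (≤-trans (p⊆q⇒∣p∣≤∣q∣ (∈fromList⁺ (y₁ ∷ y₂ ∷ []) ∘ neighbour ∘ ∈tabulate⁻))
                         (∣fromList∣≤length (y₁ ∷ y₂ ∷ [])))
                (Unique⇒length≤∣p∣ ((y₁≢y₂ ∷ []) ∷ [] ∷ [])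
                  λ { (here refl) → ∈tabulate⁺ xy₁ ; (there (here refl)) → ∈tabulate⁺ xy₂ })
      where
      no-edge-between : ∀ {p q} → p ∈ₗ y₁ ∷ y₂ ∷ [] → q ∈ₗ y₁ ∷ y₂ ∷ [] → ¬ Adj T p q
      no-edge-between (here refl)         (here refl)         pq = adj⇒≢ pq refl
      no-edge-between (here refl)         (there (here refl)) pq = no-triangle xy₁ pq (adj-sym xy₂)
      no-edge-between (there (here refl)) (here refl)         pq = no-triangle xy₂ pq (adj-sym xy₁)
      no-edge-between (there (here refl)) (there (here refl)) pq = adj⇒≢ pq refl
      neighbour : ∀ {y} → Adj T x y → y ∈ₗ y₁ ∷ y₂ ∷ []
      neighbour {y} xy with y ∈ₗ? (y₁ ∷ y₂ ∷ []) | geodetic-cover no-dominating-edge geo y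
      ... | yes y∈y₁y₂ | _        = y∈y₁y₂
      ... | no  y∉y₁y₂ | inj₁ y∈S = contradiction (S⊆ y∈S (≢-sym (adj⇒≢ xy))) y∉y₁y₂
      ... | no  _      | inj₂ (_ , _ , p∈S , q∈S , pq , _ , _ , py′ , qy′) =
        ⊥-elim (no-edge-between (S⊆ p∈S (≢-sym (adj-nonadj⇒≢ xy py′))) (S⊆ q∈S (≢-sym (adj-nonadj⇒≢ xy qy′))) pq)

    edge-in-triple : ∀ {a b c p q} → T a c ≡ false → T b c ≡ false →
                     p ∈ₗ a ∷ b ∷ c ∷ [] → q ∈ₗ a ∷ b ∷ c ∷ [] → Adj T p q → (p ≡ a × q ≡ b) ⊎ (p ≡ b × q ≡ a)
    edge-in-triple _   _   (here refl)                 (there (here refl))         _  = inj₁ (refl , refl)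
    edge-in-triple _   _   (there (here refl))         (here refl)                 _  = inj₂ (refl , refl)
    edge-in-triple _   _   (here refl)                 (here refl)                 pq = ⊥-elim (adj⇒≢ pq refl)
    edge-in-triple _   _   (there (here refl))         (there (here refl))         pq = ⊥-elim (adj⇒≢ pq refl)
    edge-in-triple _   _   (there (there (here refl))) (there (there (here refl))) pq = ⊥-elim (adj⇒≢ pq refl)
    edge-in-triple ac′ _   (here refl)                 (there (there (here refl))) pq = ⊥-elim (nonadj⇒¬adj ac′ pq)
    edge-in-triple _   bc′ (there (here refl))         (there (there (here refl))) pq = ⊥-elim (nonadj⇒¬adj bc′ pq)
    edge-in-triple ac′ _   (there (there (here refl))) (here refl)                 pq =
      ⊥-elim (nonadj⇒¬adj ac′ (adj-sym pq))
    edge-in-triple _   bc′ (there (there (here refl))) (there (here refl))         pq =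
      ⊥-elim (nonadj⇒¬adj bc′ (adj-sym pq))

    edge-with-isolated-third⇒¬geodetic : ∀ {S a b c} → (∀ {e} → e ∈ S → e ∈ₗ a ∷ b ∷ c ∷ []) →
                                         Adj T a b → T a c ≡ false → T b c ≡ false → ¬ IsGeodetic Gᶜ S
    edge-with-isolated-third⇒¬geodetic S⊆ ab ac′ bc′ geo with edge⇒outer-neighbour ab
    ... | y , ay⊎by , y≢a , y≢b with geodetic-cover no-dominating-edge geo y
    ...   | inj₁ y∈S = case S⊆ y∈S of λ
      { (here y≡a) → y≢a y≡a
      ; (there (here y≡b)) → y≢b y≡b
      ; (there (there (here y≡c))) → Sum.[ (λ ay → adj-nonadj⇒≢ (adj-sym ay) (nonadj-sym ac′) y≡c)
                                         , (λ by → adj-nonadj⇒≢ (adj-sym by) (nonadj-sym bc′) y≡c) ] ay⊎by }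
    ...   | inj₂ (_ , _ , p∈S , q∈S , pq , _ , _ , py′ , qy′) with edge-in-triple ac′ bc′ (S⊆ p∈S) (S⊆ q∈S) pq
    ...     | inj₁ (refl , refl) = Sum.[ nonadj⇒¬adj py′ , nonadj⇒¬adj qy′ ] ay⊎by
    ...     | inj₂ (refl , refl) = Sum.[ nonadj⇒¬adj qy′ , nonadj⇒¬adj py′ ] ay⊎by

    spanning-edgeAndThird⇒degree-two : ∀ {S a b c} → IsGeodetic Gᶜ S → (∀ {e} → e ∈ S → e ∈ₗ a ∷ b ∷ c ∷ []) →
                                       Adj T a b → c ≢ a → c ≢ b → Σ (Fin n) λ v → degree T v ≡ 2
    spanning-edgeAndThird⇒degree-two {S} {a} {b} {c} geo S⊆ ab c≢a c≢b with adjacency T a c | adjacency T b c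
    ... | inj₁ ac | _        = a , centre⇒degree-two geo (λ e∈S e≢a → Any.tail e≢a (S⊆ e∈S)) ab ac (≢-sym c≢b)
    ... | inj₂ _  | inj₁ bc  = b , centre⇒degree-two geo drop-b (adj-sym ab) bc (≢-sym c≢a)
      where
      drop-b : ∀ {e} → e ∈ S → e ≢ b → e ∈ₗ a ∷ c ∷ []
      drop-b e∈S e≢b with S⊆ e∈S
      ... | here e≡a          = here e≡a
      ... | there (here e≡b)  = contradiction e≡b e≢b
      ... | there (there e∈c) = there e∈c
    ... | inj₂ ac′ | inj₂ bc′ = ⊥-elim (edge-with-isolated-third⇒¬geodetic S⊆ ab ac′ bc′ geo)

    no-degree-two⇒4≤∣S∣ : Path₄ T → ¬ Σ (Fin n) (λ v → degree T v ≡ 2) → ∀ {S} → IsGeodetic Gᶜ S → 4 ≤ ∣ S ∣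
    no-degree-two⇒4≤∣S∣ P no-degree-two {S} geo with geodetic⇒edgeAndThird⊎full geo
    ... | inj₂ full = full⇒4≤∣S∣ P full
    ... | inj₁ (a , b , c , a∈S , b∈S , c∈S , ab , c≢a , c≢b) with ⊆list⊎∃∉ S (a ∷ b ∷ c ∷ [])
    ...   | inj₁ S⊆abc = contradiction (spanning-edgeAndThird⇒degree-two geo S⊆abc ab c≢a c≢b) no-degree-two
    ...   | inj₂ (e , e∈S , e∉abc) =
      Unique⇒length≤∣p∣ (¬Any⇒All¬ _ e∉abc ∷ (adj⇒≢ ab ∷ ≢-sym c≢a ∷ []) ∷ (≢-sym c≢b ∷ []) ∷ [] ∷ [])
        λ { (here refl) → e∈S ; (there (here refl)) → a∈S ; (there (there (here refl))) → b∈S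
          ; (there (there (there (here refl)))) → c∈S }

  small-diameter⇒geodetic-number-n : ∀ {d} → Diam T d → d ≤ 2 → GeodeticNumber Gᶜ n
  small-diameter⇒geodetic-number-n (bound , _) d≤2 =
    (⊤ , (λ _ → ∈⇒InInterval ∈⊤) , ∣⊤∣≡n n) ,
    λ _ geo → ≤-trans (≤-reflexive (sym (∣⊤∣≡n n))) (p⊆q⇒∣p∣≤∣q∣ {p = ⊤} (λ {w} _ → full geo w))
    where
    full : ∀ {S} → IsGeodetic Gᶜ S → ∀ w → w ∈ S
    full = dominating-edges⇒geodetic-full (distance≤2⇒edge-dominating λ a b k ab → ≤-trans (bound a b k ab) d≤2)

  diameter-3⇒geodetic-number-2 : Diam T 3 → GeodeticNumber Gᶜ 2
  diameter-3⇒geodetic-number-2 D@(bound , _) with diameter≥3⇒path₄ D ≤-refl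
  ... | path₄ s u v t su uv vt ((_ ∷ s≢v ∷ _ ∷ []) ∷ (u≢v ∷ u≢t ∷ []) ∷ _ ∷ [] ∷ []) =
    (fromList L , geo , ∣fromList∣≡length ((u≢v ∷ []) ∷ [] ∷ [])) , λ _ geo′ → geodetic⇒2≤∣S∣ geo′ u≢v
    where
    L : List (Fin n)
    L = u ∷ v ∷ []
    u∈L : u ∈ fromList L
    u∈L = ∈fromList⁺ L (here refl)
    v∈L : v ∈ fromList L
    v∈L = ∈fromList⁺ L (there (here refl))
    dom : Dominating T u v
    dom = distance≤3⇒middle-edge-dominating bound su uv vt s≢v (≢-sym u≢t)
    cover : ∀ {w} → w ≢ u → w ≢ v → InInterval Gᶜ (fromList L) w
    cover {w} w≢u w≢v with adjacency T u w | adjacency T v w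
    ... | inj₁ uw  | _        = u , v , u∈L , v∈L , dominating-edge-cover uv dom (adj-sym vt) (≢-sym u≢t) uw w≢v
    ... | inj₂ _   | inj₁ vw  =
      v , u , v∈L , u∈L , dominating-edge-cover (adj-sym uv) (dominating-sym dom) su s≢v vw w≢u
    ... | inj₂ uw′ | inj₂ vw′ = contradiction (w≢u , w≢v , uw′ , vw′) (dom w)
    geo : IsGeodetic Gᶜ (fromList L)
    geo w with w ∈ₗ? L
    ... | yes w∈L = ∈⇒InInterval (∈fromList⁺ L w∈L)
    ... | no  w∉L = cover (w∉L ∘ here) (w∉L ∘ there ∘ here)

  degree-two⇒geodetic-number-3 : ∀ {d} → Diam T d → 3 < d → Σ (Fin n) (λ v → degree T v ≡ 2) → GeodeticNumber Gᶜ 3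
  degree-two⇒geodetic-number-3 D 3<d (_ , deg) =
    degree-two⇒geodetic-triple deg ,
    λ _ geo → Sum.[ edgeAndThird⇒3≤∣S∣ , (λ full → ≤-trans (n≤1+n 3) (full⇒4≤∣S∣ P full)) ]
                  (geodetic⇒edgeAndThird⊎full (diameter>3⇒no-dominating-edge D 3<d) geo)
    where
    P : Path₄ T
    P = diameter≥3⇒path₄ D (<⇒≤ 3<d)

  no-degree-two⇒geodetic-number-4 : ∀ {d} → Diam T d → 3 < d → ¬ Σ (Fin n) (λ v → degree T v ≡ 2) →
                                    GeodeticNumber Gᶜ 4
  no-degree-two⇒geodetic-number-4 D 3<d no-degree-two =
    path₄⇒geodetic-quadruple P , λ _ → no-degree-two⇒4≤∣S∣ (diameter>3⇒no-dominating-edge D 3<d) P no-degree-two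
    where
    P : Path₄ T
    P = diameter≥3⇒path₄ D (<⇒≤ 3<d)

mainTheorem9 : (n : ℕ) (T : Graph n) → IsSimple T → IsTree T →
    ((d : ℕ) → Diam T d → d ≤ 2 → GeodeticNumber (complement T) n)
    × ((Diam T 3) → GeodeticNumber (complement T) 2)
    × ((d : ℕ) → Diam T d → 3 < d → Σ (Fin n) (λ v → degree T v ≡ 2) →
        GeodeticNumber (complement T) 3)
    × ((d : ℕ) → Diam T d → 3 < d → ¬ Σ (Fin n) (λ v → degree T v ≡ 2) →
        GeodeticNumber (complement T) 4)
mainTheorem9 n T simple tree =
  (λ _ → small-diameter⇒geodetic-number-n) ,
  diameter-3⇒geodetic-number-2 ,
  (λ _ → degree-two⇒geodetic-number-3) ,
  (λ _ → no-degree-two⇒geodetic-number-4)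
  where open Tree simple tree
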